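{- Let $G$ be a finite simple graph and $\kappa:E(G)\to[k]$ a proper edge coloring of $G$. Then the centralizer $C_{S_{V(G)}}(\mathfrak{G}_\kappa)$ of the coloring group $\mathfrak{G}_\kappa$ in the symmetric group $S_{V(G)}$ is isomorphic to $\operatorname{Aut}_\kappa(G)$.
   Context: A proper edge coloring of a graph $G$ on $k$ colors is a surjective map $\kappa:E(G)\to[k]$ such that any two edges sharing a vertex receive different colors. For $a\in[k]$, let $\tau_a\in S_{V(G)}$ be the product of the transpositions $(i,j)$ over all edges $\{i,j\}$ with $\kappa(\{i,j\})=a$ (these transpositions are disjoint, so the order does not matter). The coloring group $\mathfrak{G}_\kappa$ is the subgroup of $S_{V(G)}$ generated by $\tau_1,\dots,\tau_k$. The group $\operatorname{Aut}_\kappa(G)$ consists of all permutations $\sigma\in S_{V(G)}$ such that for every color $a$, $\{i,j\}$ is an edge of $G$ colored $a$ if and only if $\{\sigma(i),\sigma(j)\}$ is an edge of $G$ colored $a$. -}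

module Defs where

open import Data.Nat using (ℕ)
open import Data.Fin using (Fin)
open import Data.Maybe using (Maybe; just; nothing)
open import Data.Product using (Σ; ∃; ∃-syntax; _×_; _,_)
open import Data.Fin.Permutation using (Permutation′; _⟨$⟩ʳ_; _⟨$⟩ˡ_; id; _∘ₚ_; flip)
open import Relation.Binary.PropositionalEquality using (_≡_; _≢_)
open import Relation.Nullary using (¬_)
open import Function.Bundles using (_⇔_)

-- A finite simple graph on vertex set Fin n together with an edge colouring
-- in k colours, encoded as a symmetric, loop-free map
--   col i j = just a   iff  {i,j} is an edge of G with colour a,
--   col i j = nothing  iff  {i,j} is not an edge of G.
record ColouredGraph (n k : ℕ) : Set where
  field
    col      : Fin n → Fin n → Maybe (Fin k)
    col-sym  : ∀ i j → col i j ≡ col j i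
    col-loop : ∀ i → col i i ≡ nothing
open ColouredGraph public

Proper : ∀ {n k} → ColouredGraph n k → Set
Proper G = ∀ i j l a → col G i j ≡ just a → col G i l ≡ just a → j ≡ l

Surjective : ∀ {n k} → ColouredGraph n k → Set
Surjective G = ∀ a → ∃[ i ] ∃[ j ] (col G i j ≡ just a)

ProperEdgeColouring : ∀ {n k} → ColouredGraph n k → Set
ProperEdgeColouring G = Proper G × Surjective G

-- The permutation π equals τ_a, the product of the (disjoint) transpositions
-- (i j) over all edges {i,j} of colour a: it swaps the endpoints of every
-- a-coloured edge and fixes every vertex not incident to an a-coloured edge.
IsTau : ∀ {n k} → ColouredGraph n k → Fin k → Permutation′ n → Set
IsTau {n} G a π =
  (∀ i j → col G i j ≡ just a → π ⟨$⟩ʳ i ≡ j) ×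
  (∀ i → (∀ j → col G i j ≢ just a) → π ⟨$⟩ʳ i ≡ i)

data InColouringGroup {n k} (G : ColouredGraph n k) : Permutation′ n → Set where
  gen-id  : InColouringGroup G id
  gen-τ   : ∀ a π → IsTau G a π → InColouringGroup G π
  gen-mul : ∀ π ρ → InColouringGroup G π → InColouringGroup G ρ →
            InColouringGroup G (π ∘ₚ ρ)
  gen-inv : ∀ π → InColouringGroup G π → InColouringGroup G (flip π)

InCentraliser : ∀ {n k} → ColouredGraph n k → Permutation′ n → Set
InCentraliser {n} G σ =
  ∀ π → InColouringGroup G π → ∀ (i : Fin n) → σ ⟨$⟩ʳ (π ⟨$⟩ʳ i) ≡ π ⟨$⟩ʳ (σ ⟨$⟩ʳ i)

InAutκ : ∀ {n k} → ColouredGraph n k → Permutation′ n → Set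
InAutκ {n} {k} G σ =
  ∀ (i j : Fin n) (a : Fin k) → col G i j ≡ just a ⇔ col G (σ ⟨$⟩ʳ i) (σ ⟨$⟩ʳ j) ≡ just a

_≈ₚ_ : ∀ {n} → Permutation′ n → Permutation′ n → Set
σ ≈ₚ ρ = ∀ i → σ ⟨$⟩ʳ i ≡ ρ ⟨$⟩ʳ i

record SubgroupIso {n} (H K : Permutation′ n → Set) : Set where
  field
    φ       : Σ (Permutation′ n) H → Σ (Permutation′ n) K
  φ₀ : Σ (Permutation′ n) H → Permutation′ n
  φ₀ x = Σ.proj₁ (φ x)
  field
    φ-cong  : ∀ (x y : Σ (Permutation′ n) H) → Σ.proj₁ x ≈ₚ Σ.proj₁ y → φ₀ x ≈ₚ φ₀ y
    φ-inj   : ∀ (x y : Σ (Permutation′ n) H) → φ₀ x ≈ₚ φ₀ y → Σ.proj₁ x ≈ₚ Σ.proj₁ y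
    φ-surj  : ∀ (y : Σ (Permutation′ n) K) → ∃[ x ] (φ₀ x ≈ₚ Σ.proj₁ y)
    φ-hom   : ∀ (x y : Σ (Permutation′ n) H) (hxy : H (Σ.proj₁ x ∘ₚ Σ.proj₁ y)) →
              φ₀ (Σ.proj₁ x ∘ₚ Σ.proj₁ y , hxy) ≈ₚ (φ₀ x ∘ₚ φ₀ y)

{-# OPTIONS --safe #-}
module Submission where

open import Defs
open import Data.Nat using (ℕ)
open import Data.Fin using (Fin)
open import Data.Fin.Properties using (_≟_; any?)
open import Data.Fin.Permutation
  using (Permutation′; _⟨$⟩ʳ_; _⟨$⟩ˡ_; id; _∘ₚ_; flip; permutation; inverseʳ)
open import Data.Maybe using (just)
import Data.Maybe.Properties as Maybe
open import Data.Product using (∃-syntax; _×_; _,_; proj₁; proj₂)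
open import Function using (_∘_)
open import Function.Bundles using (Injection; _⇔_; mk⇔; Equivalence)
open import Function.Construct.Composition using (_⇔-∘_)
open import Function.Construct.Symmetry using (⇔-sym)
open import Function.Properties.Inverse using (↔⇒↣)
open import Relation.Binary.PropositionalEquality
open import Relation.Nullary using (¬_; Dec; yes; no; contradiction)

-- For a proper colouring the involution τ_a joins i and j exactly when
-- {i,j} is an a-coloured edge, i.e. the a-edges are the relation "τ_a moves i to j".
-- A permutation σ commutes with a permutation π iff it preserves the relation
-- "π moves i to j". Hence σ centralises every τ_a iff it preserves every colour
-- class, and centralising the generators is the same as centralising the group.
-- So the two subgroups coincide, and the identity map is the isomorphism.

private
  variable
    n k : ℕ

⟨$⟩ʳ-injective : (σ : Permutation′ n) {i j : Fin n} → σ ⟨$⟩ʳ i ≡ σ ⟨$⟩ʳ j → i ≡ j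
⟨$⟩ʳ-injective σ = Injection.injective (↔⇒↣ σ)

Commutes : Permutation′ n → Permutation′ n → Set
Commutes σ π = ∀ i → σ ⟨$⟩ʳ (π ⟨$⟩ʳ i) ≡ π ⟨$⟩ʳ (σ ⟨$⟩ʳ i)

PreservesRel : Permutation′ n → (Fin n → Fin n → Set) → Set
PreservesRel σ R = ∀ i j → R i j ⇔ R (σ ⟨$⟩ʳ i) (σ ⟨$⟩ʳ j)

PreservesRel-resp-⇔ : {R S : Fin n → Fin n → Set} → (∀ i j → R i j ⇔ S i j) →
                      (σ : Permutation′ n) → PreservesRel σ R → PreservesRel σ S
PreservesRel-resp-⇔ R⇔S σ pres i j =
  R⇔S (σ ⟨$⟩ʳ i) (σ ⟨$⟩ʳ j) ⇔-∘ (pres i j ⇔-∘ ⇔-sym (R⇔S i j))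

MovesTo : {A : Set} → (A → A) → A → A → Set
MovesTo f i j = f i ≡ j × ¬ i ≡ j

commutes⇒preservesMovesTo : (σ π : Permutation′ n) → Commutes σ π →
                            PreservesRel σ (MovesTo (π ⟨$⟩ʳ_))
commutes⇒preservesMovesTo σ π comm i j = mk⇔
  (λ (πi≡j , i≢j) → trans (sym (comm i)) (cong (σ ⟨$⟩ʳ_) πi≡j) , i≢j ∘ ⟨$⟩ʳ-injective σ)
  (λ (πσi≡σj , σi≢σj) → ⟨$⟩ʳ-injective σ (trans (comm i) πσi≡σj) , σi≢σj ∘ cong (σ ⟨$⟩ʳ_))

preservesMovesTo⇒commutes : (σ π : Permutation′ n) → PreservesRel σ (MovesTo (π ⟨$⟩ʳ_)) →
                            Commutes σ π
preservesMovesTo⇒commutes {n} σ π pres i with π ⟨$⟩ʳ i ≟ i | π ⟨$⟩ʳ (σ ⟨$⟩ʳ i) ≟ σ ⟨$⟩ʳ i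
... | no πi≢i | _ = sym (proj₁ (Equivalence.to (pres i (π ⟨$⟩ʳ i)) (refl , πi≢i ∘ sym)))
... | yes πi≡i | yes πσi≡σi = trans (cong (σ ⟨$⟩ʳ_) πi≡i) (sym πσi≡σi)
-- π fixes i but moves σ i: pulling that move back along σ makes π move i.
... | yes πi≡i | no πσi≢σi = contradiction (trans (sym πi≡i) πi≡j) i≢j
  where
    j : Fin n
    j = σ ⟨$⟩ˡ (π ⟨$⟩ʳ (σ ⟨$⟩ʳ i))
    moved : MovesTo (π ⟨$⟩ʳ_) (σ ⟨$⟩ʳ i) (σ ⟨$⟩ʳ j)
    moved = subst (MovesTo (π ⟨$⟩ʳ_) (σ ⟨$⟩ʳ i)) (sym (inverseʳ σ)) (refl , πσi≢σi ∘ sym)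
    πi≡j : π ⟨$⟩ʳ i ≡ j
    πi≡j = proj₁ (Equivalence.from (pres i j) moved)
    i≢j : ¬ i ≡ j
    i≢j = proj₂ (Equivalence.from (pres i j) moved)

commutes-id : (σ : Permutation′ n) → Commutes σ id
commutes-id σ i = refl

commutes-∘ₚ : (σ π ρ : Permutation′ n) → Commutes σ π → Commutes σ ρ → Commutes σ (π ∘ₚ ρ)
commutes-∘ₚ σ π ρ σπ σρ i = trans (σρ (π ⟨$⟩ʳ i)) (cong (ρ ⟨$⟩ʳ_) (σπ i))

commutes-flip : (σ π : Permutation′ n) → Commutes σ π → Commutes σ (flip π)
commutes-flip σ π σπ i = ⟨$⟩ʳ-injective π (begin
  π ⟨$⟩ʳ (σ ⟨$⟩ʳ (π ⟨$⟩ˡ i))  ≡⟨ sym (σπ (π ⟨$⟩ˡ i)) ⟩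
  σ ⟨$⟩ʳ (π ⟨$⟩ʳ (π ⟨$⟩ˡ i))  ≡⟨ cong (σ ⟨$⟩ʳ_) (inverseʳ π) ⟩
  σ ⟨$⟩ʳ i                    ≡⟨ sym (inverseʳ π) ⟩
  π ⟨$⟩ʳ (π ⟨$⟩ˡ (σ ⟨$⟩ʳ i))  ∎)
  where open ≡-Reasoning

subgroupIso-id : {H K : Permutation′ n → Set} →
                 (∀ σ → H σ → K σ) → (∀ σ → K σ → H σ) → SubgroupIso H K
subgroupIso-id H⊆K K⊆H = record
  { φ      = λ (σ , σ∈H) → σ , H⊆K σ σ∈H
  ; φ-cong = λ _ _ σ≈ρ → σ≈ρ
  ; φ-inj  = λ _ _ σ≈ρ → σ≈ρ
  ; φ-surj = λ (σ , σ∈K) → (σ , K⊆H σ σ∈K) , λ _ → refl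
  ; φ-hom  = λ _ _ _ _ → refl
  }

module _ (G : ColouredGraph n k) where

  Edge : Fin k → Fin n → Fin n → Set
  Edge a i j = col G i j ≡ just a

  edge? : ∀ a i j → Dec (Edge a i j)
  edge? a i j = Maybe.≡-dec _≟_ (col G i j) (just a)

  edge-irrefl : ∀ {a i j} → Edge a i j → ¬ i ≡ j
  edge-irrefl {i = i} e refl with trans (sym (col-loop G i)) e
  ... | ()

  -- IsTau G a π unfolds to SwapsColour a (π ⟨$⟩ʳ_); stating it for bare functions
  -- lets the same lemmas construct τ_a before it is known to be a permutation.
  SwapsColour : Fin k → (Fin n → Fin n) → Set
  SwapsColour a f = (∀ i j → Edge a i j → f i ≡ j) × (∀ i → (∀ j → ¬ Edge a i j) → f i ≡ i)

  swapsColour⇒edge⇔movesTo : ∀ {a f} → SwapsColour a f → ∀ i j → Edge a i j ⇔ MovesTo f i j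
  swapsColour⇒edge⇔movesTo {a} {f} (pairs , fixes) i j =
    mk⇔ (λ e → pairs i j e , edge-irrefl e) (movesTo⇒edge j)
    where
      movesTo⇒edge : ∀ l → MovesTo f i l → Edge a i l
      movesTo⇒edge .(f i) (refl , i≢fi) with any? (edge? a i)
      ... | yes (m , e) = subst (Edge a i) (sym (pairs i m e)) e
      ... | no ¬e = contradiction (sym (fixes i λ l e → ¬e (l , e))) i≢fi

  swapsColour-involutive : ∀ {a f} → SwapsColour a f → ∀ i → f (f i) ≡ i
  swapsColour-involutive {a} {f} sw i with f i ≟ i
  ... | yes fi≡i = trans (cong f fi≡i) fi≡i
  ... | no fi≢i = proj₁ sw (f i) i (trans (col-sym G (f i) i) edge)
    where
      edge : Edge a i (f i)
      edge = Equivalence.from (swapsColour⇒edge⇔movesTo sw i (f i)) (refl , fi≢i ∘ sym)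

  colourPartner : Proper G → ∀ a i →
                  ∃[ j ] ((∀ l → Edge a i l → j ≡ l) × ((∀ l → ¬ Edge a i l) → j ≡ i))
  colourPartner proper a i with any? (edge? a i)
  ... | yes (j , e) = j , (λ l e′ → proper i j l a e e′) , (λ none → contradiction e (none j))
  ... | no ¬e = i , (λ l e′ → contradiction (l , e′) ¬e) , (λ _ → refl)

  τ-exists : Proper G → ∀ a → ∃[ π ] IsTau G a π
  τ-exists proper a = permutation f f involutive involutive , swaps
    where
      f : Fin n → Fin n
      f i = proj₁ (colourPartner proper a i)
      swaps : SwapsColour a f
      swaps = (λ i → proj₁ (proj₂ (colourPartner proper a i)))
            , (λ i → proj₂ (proj₂ (colourPartner proper a i)))
      involutive : ∀ i → f (f i) ≡ i
      involutive = swapsColour-involutive swaps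

  commutes-with-colouringGroup : (σ : Permutation′ n) → (∀ a π → IsTau G a π → Commutes σ π) →
                                 ∀ π → InColouringGroup G π → Commutes σ π
  commutes-with-colouringGroup σ στ .id gen-id = commutes-id σ
  commutes-with-colouringGroup σ στ π (gen-τ a .π isτ) = στ a π isτ
  commutes-with-colouringGroup σ στ .(π ∘ₚ ρ) (gen-mul π ρ π∈𝔊 ρ∈𝔊) =
    commutes-∘ₚ σ π ρ (commutes-with-colouringGroup σ στ π π∈𝔊)
                      (commutes-with-colouringGroup σ στ ρ ρ∈𝔊)
  commutes-with-colouringGroup σ στ .(flip π) (gen-inv π π∈𝔊) =
    commutes-flip σ π (commutes-with-colouringGroup σ στ π π∈𝔊)

  centraliser⊆Autκ : Proper G → ∀ σ → InCentraliser G σ → InAutκ G σ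
  centraliser⊆Autκ proper σ central i j a =
    PreservesRel-resp-⇔ (λ i j → ⇔-sym (swapsColour⇒edge⇔movesTo isτ i j)) σ
      (commutes⇒preservesMovesTo σ τ (central τ (gen-τ a τ isτ))) i j
    where
      τ : Permutation′ n
      τ = proj₁ (τ-exists proper a)
      isτ : IsTau G a τ
      isτ = proj₂ (τ-exists proper a)

  Autκ⊆centraliser : ∀ σ → InAutκ G σ → InCentraliser G σ
  Autκ⊆centraliser σ aut = commutes-with-colouringGroup σ λ a π isτ →
    preservesMovesTo⇒commutes σ π
      (PreservesRel-resp-⇔ (swapsColour⇒edge⇔movesTo isτ) σ (λ i j → aut i j a))

theorem3p1 : ∀ (n k : ℕ) (G : ColouredGraph n k) → ProperEdgeColouring G →
    SubgroupIso (InCentraliser G) (InAutκ G)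
theorem3p1 n k G (proper , _) =
  subgroupIso-id (centraliser⊆Autκ G proper) (Autκ⊆centraliser G)
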